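{- Let $m\geq 5$ and let $L=\sum_{i=0}^{F_m-1}s(i)$, with $s$ as defined in the context. Then $L=\varphi^{m-1}$.
   Context: Fibonacci numbers: $F_1=F_2=1$, $F_k=F_{k-1}+F_{k-2}$; $\varphi=\frac{1+\sqrt5}{2}$. For fixed $m$, $\pi:\mathbb N_0\to\{0,\dots,F_m-1\}$ is $\pi(k)=kF_{m-2}\bmod F_m$, and $s:\mathbb N_0\to\{1,\varphi\}$ is given by $s(i)=\varphi$ if $\pi(i)<\pi(i+1)$ and $s(i)=1$ otherwise. -}

module Defs where

open import Data.Nat using (ℕ; zero; suc; _+_; _*_; _∸_; _<ᵇ_; NonZero)
open import Data.Nat.DivMod using (_%_)
open import Data.Bool using (if_then_else_)

fib : ℕ → ℕ
fib zero = 0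
fib (suc zero) = 1
fib (suc (suc k)) = fib (suc k) + fib k

-- The ring ℕ[φ] ⊆ ℝ, φ = (1+√5)/2: the element  a + b·φ  is  a ⊕φ b.
-- Since 1, φ are linearly independent over ℚ, equality of pairs is
-- exactly equality of the real numbers they denote.
record ℕφ : Set where
  constructor _⊕φ_
  field
    re : ℕ
    im : ℕ

one : ℕφ
one = 1 ⊕φ 0

zeroφ : ℕφ
zeroφ = 0 ⊕φ 0

φ : ℕφ
φ = 0 ⊕φ 1

infixl 6 _+φ_
infixl 7 _*φ_

_+φ_ : ℕφ → ℕφ → ℕφ
(a ⊕φ b) +φ (c ⊕φ d) = (a + c) ⊕φ (b + d)

-- (a + bφ)(c + dφ) = ac + (ad + bc)φ + bd φ² , with φ² = φ + 1
_*φ_ : ℕφ → ℕφ → ℕφ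
(a ⊕φ b) *φ (c ⊕φ d) = (a * c + b * d) ⊕φ (a * d + b * c + b * d)

_^φ_ : ℕφ → ℕ → ℕφ
x ^φ zero = one
x ^φ suc n = x *φ (x ^φ n)

sumφ : ℕ → (ℕ → ℕφ) → ℕφ
sumφ zero f = zeroφ
sumφ (suc n) f = sumφ n f +φ f n

π : (m : ℕ) → .{{NonZero (fib m)}} → ℕ → ℕ
π m k = (k * fib (m ∸ 2)) % fib m

s : (m : ℕ) → .{{NonZero (fib m)}} → ℕ → ℕφ
s m i = if π m i <ᵇ π m (suc i) then φ else one

module Submission where

-- Put n = F_m and a = F_{m-2}; then π(k) = k·a mod n is the orbit of 0
-- under the rotation x ↦ (x + a) mod n of ℤ/n.  Each step either rises by a
-- without wrapping around, or wraps (subtracts n) and falls.  Writing d(k) for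
-- the number of falls among the first k steps, π(k) + n·d(k) = k·a, so after a
-- full period (π(n) = 0) exactly a steps fall and n − a steps rise.  Since
-- s(i) = φ on rises and 1 on falls, L = a + (n − a)·φ = F_{m-2} + F_{m-1}·φ,
-- which is φ^{m-1} by the classical identity φ^{j+1} = F_j + F_{j+1}·φ.

open import Defs
open import Data.Nat using (ℕ; zero; suc; _+_; _*_; _∸_; _≤_; _<_; _<ᵇ_; _<?_; z≤n; s≤s; NonZero)
open import Data.Nat.Properties
open import Data.Nat.DivMod using (_%_; m<n⇒m%n≡m; m≤n⇒[n∸m]%m≡n%m; m%n<n; %-distribˡ-+; m*n%n≡0)
open import Data.Bool using (Bool; true; false; if_then_else_; T)
open import Data.Bool.Properties using (T-≡)
open import Data.Product using (_×_; _,_)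
open import Data.Sum using (_⊎_; inj₁; inj₂)
open import Function.Bundles using (Equivalence)
open import Relation.Nullary using (yes; no; contradiction)
open import Relation.Binary.PropositionalEquality
  using (_≡_; refl; sym; trans; cong; cong₂; subst; module ≡-Reasoning)

countTrue countFalse : (ℕ → Bool) → ℕ → ℕ
countTrue c zero = 0
countTrue c (suc k) = if c k then suc (countTrue c k) else countTrue c k
countFalse c zero = 0
countFalse c (suc k) = if c k then countFalse c k else suc (countFalse c k)

count-total : ∀ c k → countTrue c k + countFalse c k ≡ k
count-total c zero = refl
count-total c (suc k) with c k
... | true = cong suc (count-total c k)
... | false = trans (+-suc (countTrue c k) (countFalse c k)) (cong suc (count-total c k))

sum-two-valued : ∀ c k →
  sumφ k (λ i → if c i then φ else one) ≡ countFalse c k ⊕φ countTrue c k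
sum-two-valued c zero = refl
sum-two-valued c (suc k) rewrite sum-two-valued c k with c k
... | true = cong₂ _⊕φ_ (+-identityʳ _) (+-comm _ 1)
... | false = cong₂ _⊕φ_ (+-comm _ 1) (+-identityʳ _)

<ᵇ-true : ∀ {x y} → x < y → (x <ᵇ y) ≡ true
<ᵇ-true x<y = Equivalence.to T-≡ (<⇒<ᵇ x<y)

<ᵇ-false : ∀ {x y} → y < x → (x <ᵇ y) ≡ false
<ᵇ-false {x} {y} y<x with x <ᵇ y in eq
... | false = refl
... | true = contradiction (<ᵇ⇒< x y (subst T (sym eq) _)) (<⇒≯ y<x)

rise-or-fall : ∀ {n x a} .{{_ : NonZero n}} → x < n → 0 < a → a < n →
  (x < (x + a) % n × (x + a) % n ≡ x + a) ⊎
  ((x + a) % n < x × (x + a) % n + n ≡ x + a)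
rise-or-fall {n} {x} {a} x<n 0<a a<n with x + a <? n
... | yes x+a<n = inj₁ (subst (x <_) (sym noWrap) (m<m+n x 0<a) , noWrap)
  where
  noWrap : (x + a) % n ≡ x + a
  noWrap = m<n⇒m%n≡m x+a<n
... | no x+a≮n = inj₂ (subst (_< x) (sym wrap) fallen , trans (cong (_+ n) wrap) (m∸n+n≡m n≤x+a))
  where
  n≤x+a : n ≤ x + a
  n≤x+a = ≮⇒≥ x+a≮n
  below : ∀ {b} → x + a < b + n → x + a ∸ n < b
  below {b} bound = +-cancelʳ-< n (x + a ∸ n) b (subst (_< b + n) (sym (m∸n+n≡m n≤x+a)) bound)
  wrap : (x + a) % n ≡ x + a ∸ n
  wrap = trans (sym (m≤n⇒[n∸m]%m≡n%m n≤x+a)) (m<n⇒m%n≡m (below (+-mono-< x<n a<n)))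
  fallen : x + a ∸ n < x
  fallen = below (+-monoʳ-< x a<n)

module Rotation (n a : ℕ) .{{_ : NonZero n}} (0<a : 0 < a) (a<n : a < n) where

  orbit : ℕ → ℕ
  orbit k = (k * a) % n

  rises : ℕ → Bool
  rises k = orbit k <ᵇ orbit (suc k)

  orbit-suc : ∀ k → orbit (suc k) ≡ (orbit k + a) % n
  orbit-suc k = begin
      (a + k * a) % n        ≡⟨ %-distribˡ-+ a (k * a) n ⟩
      (a % n + orbit k) % n  ≡⟨ cong (λ r → (r + orbit k) % n) (m<n⇒m%n≡m a<n) ⟩
      (a + orbit k) % n      ≡⟨ cong (_% n) (+-comm a (orbit k)) ⟩
      (orbit k + a) % n      ∎
    where open ≡-Reasoning

  -- Invariant: each fall removes one copy of n from the running sum k·a.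
  orbit-falls : ∀ k → orbit k + n * countFalse rises k ≡ k * a
  orbit-falls zero rewrite *-zeroʳ n = trans (+-identityʳ _) (m<n⇒m%n≡m (<-trans 0<a a<n))
  orbit-falls (suc k)
    with rise-or-fall {a = a} (m%n<n (k * a) n) 0<a a<n
  ... | inj₁ (up , noWrap) rewrite <ᵇ-true (subst (orbit k <_) (sym (orbit-suc k)) up) = begin
      orbit (suc k) + n * d    ≡⟨ cong (_+ n * d) (trans (orbit-suc k) noWrap) ⟩
      orbit k + a + n * d      ≡⟨ cong (_+ n * d) (+-comm (orbit k) a) ⟩
      a + orbit k + n * d      ≡⟨ +-assoc a (orbit k) (n * d) ⟩
      a + (orbit k + n * d)    ≡⟨ cong (a +_) (orbit-falls k) ⟩
      a + k * a                ∎
    where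
    open ≡-Reasoning
    d = countFalse rises k
  ... | inj₂ (down , wrap) rewrite <ᵇ-false (subst (_< orbit k) (sym (orbit-suc k)) down) = begin
      orbit (suc k) + n * suc d    ≡⟨ cong (orbit (suc k) +_) (*-suc n d) ⟩
      orbit (suc k) + (n + n * d)  ≡⟨ sym (+-assoc (orbit (suc k)) n (n * d)) ⟩
      orbit (suc k) + n + n * d    ≡⟨ cong (λ y → y + n + n * d) (orbit-suc k) ⟩
      (orbit k + a) % n + n + n * d ≡⟨ cong (_+ n * d) wrap ⟩
      orbit k + a + n * d          ≡⟨ cong (_+ n * d) (+-comm (orbit k) a) ⟩
      a + orbit k + n * d          ≡⟨ +-assoc a (orbit k) (n * d) ⟩
      a + (orbit k + n * d)        ≡⟨ cong (a +_) (orbit-falls k) ⟩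
      a + k * a                    ∎
    where
    open ≡-Reasoning
    d = countFalse rises k

  -- Over one full period the orbit returns to 0, so exactly a steps fall ...
  falls-per-period : countFalse rises n ≡ a
  falls-per-period = *-cancelˡ-≡ _ _ n (begin
      n * countFalse rises n              ≡⟨ cong (_+ n * countFalse rises n) back-to-0 ⟨
      orbit n + n * countFalse rises n    ≡⟨ orbit-falls n ⟩
      n * a                               ∎)
    where
    open ≡-Reasoning
    back-to-0 : orbit n ≡ 0
    back-to-0 = trans (cong (_% n) (*-comm n a)) (m*n%n≡0 a n)

  rises-per-period : countTrue rises n ≡ n ∸ a
  rises-per-period = trans (sym (m+n∸n≡m (countTrue rises n) (countFalse rises n)))
                           (cong₂ _∸_ (count-total rises n) falls-per-period)

fib-pos : ∀ j → 0 < fib (suc j)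
fib-pos zero = s≤s z≤n
fib-pos (suc j) = ≤-trans (fib-pos j) (m≤m+n _ _)

-- F_{j+1} < F_{j+3}: the step F_{m-2} of the rotation is a proper one.
fib-step< : ∀ j → fib (suc j) < fib (suc (suc (suc j)))
fib-step< j = +-monoˡ-≤ (fib (suc j)) (fib-pos (suc j))

φ-power : ∀ j → φ ^φ suc j ≡ fib j ⊕φ fib (suc j)
φ-power zero = refl
φ-power (suc j) = trans (cong (φ *φ_) (φ-power j)) (φ-times (fib j) (fib (suc j)))
  where
  φ-times : ∀ a b → φ *φ (a ⊕φ b) ≡ b ⊕φ (b + a)
  φ-times a b = cong₂ _⊕φ_ (+-identityʳ b)
    (trans (cong₂ _+_ (+-identityʳ a) (+-identityʳ b)) (+-comm a b))

-- With m = j + 3, s m is the rise indicator of the rotation of ℤ/F_{j+3} by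
-- F_{j+1}; so L has F_{j+1} ones and F_{j+3} − F_{j+1} = F_{j+2} copies of φ.
lemma1 : (m : ℕ) → 5 ≤ m → .{{_ : NonZero (fib m)}} →
             sumφ (fib m) (s m) ≡ φ ^φ (m ∸ 1)
lemma1 (suc (suc (suc j))) (s≤s (s≤s (s≤s _))) = begin
    sumφ n (s m)                                    ≡⟨ sum-two-valued R.rises n ⟩
    countFalse R.rises n ⊕φ countTrue R.rises n     ≡⟨ cong₂ _⊕φ_ R.falls-per-period R.rises-per-period ⟩
    fib (suc j) ⊕φ (n ∸ fib (suc j))                ≡⟨ cong (fib (suc j) ⊕φ_) (m+n∸n≡m (fib (suc (suc j))) (fib (suc j))) ⟩
    fib (suc j) ⊕φ fib (suc (suc j))                ≡⟨ φ-power (suc j) ⟨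
    φ ^φ suc (suc j)                                ∎
  where
  open ≡-Reasoning
  m = suc (suc (suc j))
  n = fib m
  module R = Rotation n (fib (suc j)) (fib-pos j) (fib-step< j)
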